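{- There is no $\mathsf{TOTO}$ sentence $\psi$ such that, for every permutation $\sigma$, $\sigma\models\psi$ if and only if $\sigma$ has a fixed point.
   Context: A permutation $\sigma$ of size $n$ is identified with the finite structure with domain $A^\sigma=\{(i,\sigma(i)) : 1\le i\le n\}$, position order $<_P$ (comparing first coordinates) and value order $<_V$ (comparing second coordinates); $\mathsf{TOTO}$ is first-order logic (with equality) over the signature of two binary relation symbols $<_P,<_V$. A fixed point of $\sigma$ is an $i$ with $\sigma(i)=i$. -}

module Defs where

open import Data.Nat using (ℕ; suc)
open import Data.Fin using (Fin; zero; suc; _<_)
open import Data.Fin.Permutation using (Permutation′; _⟨$⟩ʳ_)
open import Data.Product using (_×_; Σ; ∃)
open import Data.Sum using (_⊎_)
open import Data.Empty using (⊥)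
open import Data.Unit using (⊤)
open import Relation.Binary.PropositionalEquality using (_≡_)

-- First-order formulas of TOTO (first-order logic with equality over the
-- signature {<_P, <_V}), with variables as de Bruijn indices: a
-- Formula k has its free variables among Fin k.
data Formula (k : ℕ) : Set where
  ⊤ᶠ ⊥ᶠ : Formula k
  _≐_   : Fin k → Fin k → Formula k
  _<P_  : Fin k → Fin k → Formula k
  _<V_  : Fin k → Fin k → Formula k
  ¬ᶠ_   : Formula k → Formula k
  _∧ᶠ_ _∨ᶠ_ _⇒ᶠ_ : Formula k → Formula k → Formula k
  ∀ᶠ ∃ᶠ : Formula (suc k) → Formula k

Sentence : Set
Sentence = Formula 0

_∷ₑ_ : ∀ {n k} → Fin n → (Fin k → Fin n) → Fin (suc k) → Fin n
(a ∷ₑ ρ) zero    = a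
(a ∷ₑ ρ) (suc x) = ρ x

-- The structure of a permutation σ of size n: the domain
-- A^σ = {(i, σ(i))} is identified with Fin n via its first coordinate i;
-- (i,σ i) <_P (j,σ j) iff i < j, and (i,σ i) <_V (j,σ j) iff σ i < σ j.
_,_⊨_ : ∀ {n k} → Permutation′ n → (Fin k → Fin n) → Formula k → Set
σ , ρ ⊨ ⊤ᶠ       = ⊤
σ , ρ ⊨ ⊥ᶠ       = ⊥
σ , ρ ⊨ (x ≐ y)  = ρ x ≡ ρ y
σ , ρ ⊨ (x <P y) = ρ x < ρ y
σ , ρ ⊨ (x <V y) = (σ ⟨$⟩ʳ ρ x) < (σ ⟨$⟩ʳ ρ y)
σ , ρ ⊨ (¬ᶠ φ)   = σ , ρ ⊨ φ → ⊥
σ , ρ ⊨ (φ ∧ᶠ ψ) = (σ , ρ ⊨ φ) × (σ , ρ ⊨ ψ)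
σ , ρ ⊨ (φ ∨ᶠ ψ) = (σ , ρ ⊨ φ) ⊎ (σ , ρ ⊨ ψ)
σ , ρ ⊨ (φ ⇒ᶠ ψ) = (σ , ρ ⊨ φ) → (σ , ρ ⊨ ψ)
σ , ρ ⊨ ∀ᶠ φ     = ∀ a → σ , (a ∷ₑ ρ) ⊨ φ
σ , ρ ⊨ ∃ᶠ φ     = Σ _ λ a → σ , (a ∷ₑ ρ) ⊨ φ

ρ₀ : ∀ {n} → Fin 0 → Fin n
ρ₀ ()

_⊨_ : ∀ {n} → Permutation′ n → Sentence → Set
σ ⊨ ψ = σ , ρ₀ ⊨ ψ

HasFixedPoint : ∀ {n} → Permutation′ n → Set
HasFixedPoint σ = ∃ λ i → σ ⟨$⟩ʳ i ≡ i

module Submission where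

-- On the decreasing permutation of size n the value order is the converse of
-- the position order, so a TOTO sentence of quantifier rank r sees no more than a
-- first-order sentence about a linear order of size n.  Such orders of sizes at
-- least 2^r agree on all sentences of rank r: the duplicator keeps every distance
-- between chosen elements (and the two ends of the order) either equal or at
-- least 2^(rounds left) on both sides, splitting a long gap into two long gaps
-- when the spoiler plays inside it.  The decreasing permutation has a fixed point
-- exactly when its size is odd, so sizes 2·2^r + 1 and 2·2^r defeat any sentence.

open import Defs
open import Data.Nat using (ℕ)
open import Data.Product using (Σ)
open import Data.Fin.Permutation using (Permutation′)
open import Function.Bundles using (_⇔_)
open import Relation.Nullary using (¬_)

open import Data.Fin as Fin using (Fin; zero; suc; toℕ; fromℕ<; opposite; _↑ˡ_)
open import Data.Fin.Permutation using (reverse)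
open import Data.Fin.Properties using (toℕ-injective; toℕ<n; toℕ-fromℕ<; opposite-prop)
open import Data.Nat using (zero; suc; _+_; _*_; _∸_; _^_; _⊔_; _≤_; _<_; z≤n; s≤s; s≤s⁻¹; s<s; s<s⁻¹; _<?_)
open import Data.Nat.Properties
open import Data.Product using (_×_; _,_; proj₁; proj₂; ∃; ∃₂)
open import Data.Sum using (_⊎_; inj₁; inj₂)
open import Data.Unit using (tt)
open import Data.Vec.Functional using (_∷_)
open import Function using (_∘_)
open import Function.Bundles using (Equivalence; mk⇔)
open import Relation.Binary.Bundles using (DecTotalOrder)
import Relation.Binary.Construct.Flip.EqAndOrd as Flip
open import Relation.Binary.PropositionalEquality
  using (_≡_; refl; sym; trans; cong; cong₂; subst; subst₂; _≗_; module ≡-Reasoning)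
open import Relation.Nullary using (Dec; yes; no; contradiction)

private variable
  a b d e g t u x y z k m n n' : ℕ

infix 4 _≈[_]_

_≈[_]_ : ℕ → ℕ → ℕ → Set
a ≈[ t ] b = a ≡ b ⊎ (t ≤ a × t ≤ b)

≈-sym : a ≈[ t ] b → b ≈[ t ] a
≈-sym (inj₁ a≡b)         = inj₁ (sym a≡b)
≈-sym (inj₂ (t≤a , t≤b)) = inj₂ (t≤b , t≤a)

≈-weaken : u ≤ t → a ≈[ t ] b → a ≈[ u ] b
≈-weaken u≤t (inj₁ a≡b)         = inj₁ a≡b
≈-weaken u≤t (inj₂ (t≤a , t≤b)) = inj₂ (≤-trans u≤t t≤a , ≤-trans u≤t t≤b)

≈-zero : 1 ≤ t → 0 ≈[ t ] b → b ≡ 0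
≈-zero _       (inj₁ 0≡b)     = sym 0≡b
≈-zero (s≤s _) (inj₂ (() , _))

≈-+ : a ≈[ t ] b → d ≈[ t ] e → a + d ≈[ t ] b + e
≈-+ (inj₁ refl) (inj₁ refl) = inj₁ refl
≈-+ {a} {d = d} {e} (inj₁ refl) (inj₂ (t≤d , t≤e)) =
  inj₂ (≤-trans t≤d (m≤n+m d a) , ≤-trans t≤e (m≤n+m e a))
≈-+ {a} {b = b} {d} {e} (inj₂ (t≤a , t≤b)) _ =
  inj₂ (≤-trans t≤a (m≤m+n a d) , ≤-trans t≤b (m≤m+n b e))

-- If one side is below the threshold it is copied exactly; otherwise each part gets at least t.
≈-split : d + e ≈[ t + t ] g → ∃₂ λ d' e' → d' + e' ≡ g × d ≈[ t ] d' × e ≈[ t ] e'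
≈-split {d} {e} (inj₁ refl) = d , e , refl , inj₁ refl , inj₁ refl
≈-split {d} {e} {t} {g} (inj₂ (2t≤d+e , 2t≤g)) = split (d <? t) (e <? t)
  where
  t≤g : t ≤ g
  t≤g = ≤-trans (m≤m+n t t) 2t≤g
  rest-≥ : x < t → t ≤ g ∸ x
  rest-≥ x<t = m+n≤o⇒m≤o∸n t (≤-trans (+-monoʳ-≤ t (<⇒≤ x<t)) 2t≤g)
  split : Dec (d < t) → Dec (e < t) → ∃₂ λ d' e' → d' + e' ≡ g × d ≈[ t ] d' × e ≈[ t ] e'
  split (yes d<t) (yes e<t) = contradiction 2t≤d+e (<⇒≱ (+-mono-< d<t e<t))
  split (yes d<t) (no e≮t)  = d , g ∸ d , m+[n∸m]≡n (≤-trans (<⇒≤ d<t) t≤g) ,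
                              inj₁ refl , inj₂ (≮⇒≥ e≮t , rest-≥ d<t)
  split (no d≮t)  (yes e<t) = g ∸ e , e , m∸n+n≡m (≤-trans (<⇒≤ e<t) t≤g) ,
                              inj₂ (≮⇒≥ d≮t , rest-≥ e<t) , inj₁ refl
  split (no d≮t)  (no e≮t)  = t , g ∸ t , m+[n∸m]≡n t≤g ,
                              inj₂ (≮⇒≥ d≮t , ≤-refl) , inj₂ (≮⇒≥ e≮t , m+n≤o⇒m≤o∸n t 2t≤g)

∸-split : x ≤ y → y ≤ z → z ∸ x ≡ (y ∸ x) + (z ∸ y)
∸-split {zero}              _         y≤z       = sym (m+[n∸m]≡n y≤z)
∸-split {suc x} {suc y} {suc z} (s≤s x≤y) (s≤s y≤z) = ∸-split x≤y y≤z

module _ {c ℓ₁ ℓ₂} (O : DecTotalOrder c ℓ₁ ℓ₂) where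
  open DecTotalOrder O using () renaming
    (Carrier to C; _≤_ to _≼_; _≤?_ to _≼?_; refl to ≼-refl; trans to ≼-trans; total to ≼-total)

  IsGreatestBelow : (Fin m → C) → C → Fin m → Set ℓ₂
  IsGreatestBelow f a i = f i ≼ a × (∀ j → f j ≼ a → f j ≼ f i)

  greatest-below? : (f : Fin m → C) (a : C) → (∀ j → ¬ f j ≼ a) ⊎ ∃ (IsGreatestBelow f a)
  greatest-below? {zero}  f a = inj₁ λ ()
  greatest-below? {suc m} f a with greatest-below? (f ∘ suc) a | f zero ≼? a
  ... | inj₁ none | no f₀⋠a = inj₁ λ { zero → f₀⋠a ; (suc j) → none j }
  ... | inj₁ none | yes f₀≼a =
    inj₂ (zero , f₀≼a , λ { zero _ → ≼-refl ; (suc j) fj≼a → contradiction fj≼a (none j) })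
  ... | inj₂ (i , fi≼a , max) | no f₀⋠a =
    inj₂ (suc i , fi≼a , λ { zero f₀≼a → contradiction f₀≼a f₀⋠a ; (suc j) → max j })
  ... | inj₂ (i , fi≼a , max) | yes f₀≼a with ≼-total (f zero) (f (suc i))
  ...   | inj₁ f₀≼fi = inj₂ (suc i , fi≼a , λ { zero _ → f₀≼fi ; (suc j) → max j })
  ...   | inj₂ fi≼f₀ = inj₂ (zero , f₀≼a , λ { zero _ → ≼-refl ; (suc j) fj≼a → ≼-trans (max j fj≼a) fi≼f₀ })

  greatest-below : (f : Fin m → C) {a : C} (j : Fin m) → f j ≼ a → ∃ (IsGreatestBelow f a)
  greatest-below f j fj≼a with greatest-below? f _
  ... | inj₁ none  = contradiction fj≼a (none j)
  ... | inj₂ found = found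

IsLeastAbove : (Fin m → ℕ) → ℕ → Fin m → Set
IsLeastAbove = IsGreatestBelow (Flip.decTotalOrder ≤-decTotalOrder)

least-above : (f : Fin m → ℕ) {a : ℕ} (j : Fin m) → a ≤ f j → ∃ (IsLeastAbove f a)
least-above = greatest-below (Flip.decTotalOrder ≤-decTotalOrder)

private variable
  E E' : Fin m → ℕ
  l p₀ p₁ : Fin m

-- Truncated subtraction makes E q ∸ E p vanish exactly when E q ≤ E p,
-- so matching all gaps also forces E and E' to order the points alike.
record Similar (t : ℕ) (E E' : Fin m → ℕ) : Set where
  constructor similar
  field gap : ∀ p q → E q ∸ E p ≈[ t ] E' q ∸ E' p
open Similar

Similar-sym : Similar t E E' → Similar t E' E
Similar-sym s = similar λ p q → ≈-sym (gap s p q)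

Similar-weaken : u ≤ t → Similar t E E' → Similar u E E'
Similar-weaken u≤t s = similar λ p q → ≈-weaken u≤t (gap s p q)

Similar-cong : ∀ {E₁ E₂ E₁' E₂' : Fin m → ℕ} → E₁ ≗ E₂ → E₁' ≗ E₂' → Similar t E₁ E₁' → Similar t E₂ E₂'
Similar-cong {t = t} eq eq' s = similar λ p q →
  subst₂ (_≈[ t ]_) (cong₂ _∸_ (eq q) (eq p)) (cong₂ _∸_ (eq' q) (eq' p)) (gap s p q)

Similar-≤ : 1 ≤ t → Similar t E E' → ∀ p q → E p ≤ E q → E' p ≤ E' q
Similar-≤ {t = t} {E' = E'} 1≤t s p q Ep≤Eq =
  m∸n≡0⇒m≤n (≈-zero 1≤t (subst (_≈[ t ] E' p ∸ E' q) (m≤n⇒m∸n≡0 Ep≤Eq) (gap s q p)))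

Similar-< : 1 ≤ t → Similar t E E' → ∀ p q → E p < E q → E' p < E' q
Similar-< 1≤t s p q Ep<Eq = ≰⇒> λ E'q≤E'p → <⇒≱ Ep<Eq (Similar-≤ 1≤t (Similar-sym s) q p E'q≤E'p)

GapsMatch : ℕ → (Fin m → ℕ) → (Fin m → ℕ) → ℕ → ℕ → Set
GapsMatch t E E' a b = ∀ p → a ∸ E p ≈[ t ] b ∸ E' p × E p ∸ a ≈[ t ] E' p ∸ b

Similar-∷ : Similar t E E' → GapsMatch t E E' a b → Similar t (a ∷ E) (b ∷ E')
Similar-∷ {a = a} {b = b} s match = similar λ where
  zero    zero    → inj₁ (trans (n∸n≡0 a) (sym (n∸n≡0 b)))
  zero    (suc q) → proj₂ (match q)
  (suc p) zero    → proj₁ (match p)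
  (suc p) (suc q) → gap s p q

GapsMatch-between : ∀ {u} → 1 ≤ t → Similar t E E' →
  IsGreatestBelow ≤-decTotalOrder E a l → IsLeastAbove E a u → E' l ≤ b → b ≤ E' u →
  a ∸ E l ≈[ t ] b ∸ E' l → E u ∸ a ≈[ t ] E' u ∸ b → GapsMatch t E E' a b
GapsMatch-between {t = t} {E = E} {E' = E'} {a = a} {l = l} {b = b} {u = u}
                  1≤t s (El≤a , below) (a≤Eu , above) E'l≤b b≤E'u left right p with E p ≤? a
... | yes Ep≤a = subst₂ (_≈[ t ]_) (sym (∸-split Ep≤El El≤a)) (sym (∸-split E'p≤E'l E'l≤b))
                   (≈-+ (gap s p l) left)
               , inj₁ (trans (m≤n⇒m∸n≡0 Ep≤a) (sym (m≤n⇒m∸n≡0 (≤-trans E'p≤E'l E'l≤b))))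
  where
  Ep≤El : E p ≤ E l
  Ep≤El = below p Ep≤a
  E'p≤E'l : E' p ≤ E' l
  E'p≤E'l = Similar-≤ 1≤t s p l Ep≤El
... | no Ep≰a = inj₁ (trans (m≤n⇒m∸n≡0 a≤Ep) (sym (m≤n⇒m∸n≡0 (≤-trans b≤E'u E'u≤E'p))))
              , subst₂ (_≈[ t ]_) (sym (∸-split a≤Eu Eu≤Ep)) (sym (∸-split b≤E'u E'u≤E'p))
                  (≈-+ right (gap s u p))
  where
  a≤Ep : a ≤ E p
  a≤Ep = ≰⇒≥ Ep≰a
  Eu≤Ep : E u ≤ E p
  Eu≤Ep = above p a≤Ep
  E'u≤E'p : E' u ≤ E' p
  E'u≤E'p = Similar-≤ 1≤t s u p Eu≤Ep

duplicator-move : 1 ≤ t → Similar (2 * t) E E' → E p₀ ≤ a → a ≤ E p₁ → ∃ λ b → Similar t (a ∷ E) (b ∷ E')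
duplicator-move {t = t} {E = E} {E' = E'} {a = a} 1≤t s p₀≤a a≤p₁
  with greatest-below ≤-decTotalOrder E _ p₀≤a
     | least-above E _ a≤p₁
... | l , below@(El≤a , _) | u , above@(a≤Eu , _)
  with ≈-split (subst (_≈[ t + t ] E' u ∸ E' l) (∸-split El≤a a≤Eu)
                 (≈-weaken (≤-reflexive (cong (t +_) (sym (+-identityʳ t)))) (gap s l u)))
... | d' , e' , d'+e'≡gap , left , right =
  E' l + d' , Similar-∷ s₁ (GapsMatch-between 1≤t s₁ below above (m≤m+n (E' l) d') b≤E'u
                              (subst (_ ≈[ t ]_) (sym (m+n∸m≡n (E' l) d')) left)
                              (subst (_ ≈[ t ]_) (sym E'u∸b≡e') right))
  where
  s₁ : Similar t E E'
  s₁ = Similar-weaken (m≤m+n t (t + 0)) s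
  E'l≤E'u : E' l ≤ E' u
  E'l≤E'u = Similar-≤ 1≤t s₁ l u (≤-trans El≤a a≤Eu)
  E'u≡b+e' : E' u ≡ E' l + d' + e'
  E'u≡b+e' = begin
    E' u                  ≡⟨ m+[n∸m]≡n E'l≤E'u ⟨
    E' l + (E' u ∸ E' l)  ≡⟨ cong (E' l +_) d'+e'≡gap ⟨
    E' l + (d' + e')      ≡⟨ +-assoc (E' l) d' e' ⟨
    E' l + d' + e'        ∎
    where open ≡-Reasoning
  E'u∸b≡e' : E' u ∸ (E' l + d') ≡ e'
  E'u∸b≡e' = trans (cong (_∸ (E' l + d')) E'u≡b+e') (m+n∸m≡n (E' l + d') e')
  b≤E'u : E' l + d' ≤ E' u
  b≤E'u = subst (E' l + d' ≤_) (sym E'u≡b+e') (m≤m+n (E' l + d') e')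

Pt : ℕ → Set
Pt k = Fin (k + 2)

var : Fin k → Pt k
var x = x ↑ˡ 2

lo hi : Pt k
lo {zero}  = zero
lo {suc k} = suc lo
hi {zero}  = suc zero
hi {suc k} = suc hi

-- Chosen elements sit at 1, …, n; the endpoints lo ↦ 0 and hi ↦ n + 1
-- give every newly chosen element a neighbour on each side.
position : (Fin k → Fin n) → Pt k → ℕ
position {zero}  {n} ρ zero       = 0
position {zero}  {n} ρ (suc zero) = suc n
position {suc k}     ρ zero       = suc (toℕ (ρ zero))
position {suc k}     ρ (suc p)    = position (ρ ∘ suc) p

position-lo : (ρ : Fin k → Fin n) → position ρ lo ≡ 0
position-lo {zero}  ρ = refl
position-lo {suc k} ρ = position-lo (ρ ∘ suc)

position-hi : (ρ : Fin k → Fin n) → position ρ hi ≡ suc n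
position-hi {zero}  ρ = refl
position-hi {suc k} ρ = position-hi (ρ ∘ suc)

position-var : (ρ : Fin k → Fin n) (x : Fin k) → position ρ (var x) ≡ suc (toℕ (ρ x))
position-var ρ zero    = refl
position-var ρ (suc x) = position-var (ρ ∘ suc) x

private variable
  ρ : Fin k → Fin n
  ρ' : Fin k → Fin n'

Similar-var-≤ : 1 ≤ t → Similar t (position ρ) (position ρ') →
  ∀ x y → ρ x Fin.≤ ρ y → ρ' x Fin.≤ ρ' y
Similar-var-≤ {ρ = ρ} {ρ' = ρ'} 1≤t s x y ρx≤ρy = s≤s⁻¹
  (subst₂ _≤_ (position-var ρ' x) (position-var ρ' y)
    (Similar-≤ 1≤t s (var x) (var y)
      (subst₂ _≤_ (sym (position-var ρ x)) (sym (position-var ρ y)) (s≤s ρx≤ρy))))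

Similar-var-< : 1 ≤ t → Similar t (position ρ) (position ρ') →
  ∀ x y → ρ x Fin.< ρ y → ρ' x Fin.< ρ' y
Similar-var-< {ρ = ρ} {ρ' = ρ'} 1≤t s x y ρx<ρy = s<s⁻¹
  (subst₂ _<_ (position-var ρ' x) (position-var ρ' y)
    (Similar-< 1≤t s (var x) (var y)
      (subst₂ _<_ (sym (position-var ρ x)) (sym (position-var ρ y)) (s<s ρx<ρy))))

Similar-ρ₀ : t ≤ suc n → t ≤ suc n' → Similar t (position {n = n} ρ₀) (position {n = n'} ρ₀)
Similar-ρ₀ {n = n} {n' = n'} t≤n t≤n' = similar λ where
  zero       zero       → inj₁ refl
  zero       (suc zero) → inj₂ (t≤n , t≤n')
  (suc zero) zero       → inj₁ refl
  (suc zero) (suc zero) → inj₁ (trans (n∸n≡0 n) (sym (n∸n≡0 n')))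

duplicator-move-Fin : ∀ {t k n n'} {ρ : Fin k → Fin n} {ρ' : Fin k → Fin n'} →
  1 ≤ t → Similar (2 * t) (position ρ) (position ρ') →
  ∀ α → ∃ λ β → Similar t (position (α ∷ₑ ρ)) (position (β ∷ₑ ρ'))
duplicator-move-Fin {t} {n' = n'} {ρ} {ρ'} 1≤t s α =
  let b , s' = duplicator-move 1≤t s (<⇒≤ lo<α) (<⇒≤ α<hi)
  in relabel b s' (subst (_< b) (position-lo ρ') (Similar-< 1≤t s' (suc lo) zero lo<α))
                  (subst (b <_) (position-hi ρ') (Similar-< 1≤t s' zero (suc hi) α<hi))
  where
  lo<α : position ρ lo < suc (toℕ α)
  lo<α = subst (_< suc (toℕ α)) (sym (position-lo ρ)) (s≤s z≤n)
  α<hi : suc (toℕ α) < position ρ hi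
  α<hi = subst (suc (toℕ α) <_) (sym (position-hi ρ)) (s<s (toℕ<n α))
  relabel : ∀ b → Similar t (suc (toℕ α) ∷ position ρ) (b ∷ position ρ') →
            0 < b → b < suc n' → ∃ λ β → Similar t (position (α ∷ₑ ρ)) (position (β ∷ₑ ρ'))
  relabel (suc b) s' _ (s<s b<n') = fromℕ< b<n' , Similar-cong
    (λ { zero → refl ; (suc p) → refl })
    (λ { zero → cong suc (sym (toℕ-fromℕ< b<n')) ; (suc p) → refl }) s'

opposite-<-⇔ : ∀ {n} {i j : Fin n} → opposite i Fin.< opposite j ⇔ j Fin.< i
opposite-<-⇔ {n} {i} {j} = mk⇔
  (λ h → s<s⁻¹ (∸-cancelʳ-< {o = n} (subst₂ _<_ (opposite-prop i) (opposite-prop j) h)))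
  (λ h → subst₂ _<_ (sym (opposite-prop i)) (sym (opposite-prop j)) (∸-monoʳ-< (s<s h) (toℕ<n i)))

rank : Formula k → ℕ
rank ⊤ᶠ       = 0
rank ⊥ᶠ       = 0
rank (_ ≐ _)  = 0
rank (_ <P _) = 0
rank (_ <V _) = 0
rank (¬ᶠ φ)   = rank φ
rank (φ ∧ᶠ ψ) = rank φ ⊔ rank ψ
rank (φ ∨ᶠ ψ) = rank φ ⊔ rank ψ
rank (φ ⇒ᶠ ψ) = rank φ ⊔ rank ψ
rank (∀ᶠ φ)   = suc (rank φ)
rank (∃ᶠ φ)   = suc (rank φ)

⊨-reverse-transfer : ∀ {k n n' r} (φ : Formula k) {ρ : Fin k → Fin n} {ρ' : Fin k → Fin n'} →
  rank φ ≤ r → Similar (2 ^ r) (position ρ) (position ρ') → _,_⊨_ reverse ρ φ → _,_⊨_ reverse ρ' φ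
⊨-reverse-transfer ⊤ᶠ _ _ _ = tt
⊨-reverse-transfer ⊥ᶠ _ _ ()
⊨-reverse-transfer {r = r} (x ≐ y) _ s ρx≡ρy = toℕ-injective (≤-antisym
  (Similar-var-≤ (m^n>0 2 r) s x y (≤-reflexive (cong toℕ ρx≡ρy)))
  (Similar-var-≤ (m^n>0 2 r) s y x (≤-reflexive (cong toℕ (sym ρx≡ρy)))))
⊨-reverse-transfer {r = r} (x <P y) _ s ρx<ρy = Similar-var-< (m^n>0 2 r) s x y ρx<ρy
⊨-reverse-transfer {r = r} (x <V y) _ s h =
  Equivalence.from opposite-<-⇔ (Similar-var-< (m^n>0 2 r) s y x (Equivalence.to opposite-<-⇔ h))
⊨-reverse-transfer (¬ᶠ φ) r≥ s ¬h h' = ¬h (⊨-reverse-transfer φ r≥ (Similar-sym s) h')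
⊨-reverse-transfer (φ ∧ᶠ ψ) r≥ s (h₁ , h₂) =
  ⊨-reverse-transfer φ (m⊔n≤o⇒m≤o _ _ r≥) s h₁ , ⊨-reverse-transfer ψ (m⊔n≤o⇒n≤o _ _ r≥) s h₂
⊨-reverse-transfer (φ ∨ᶠ ψ) r≥ s (inj₁ h) = inj₁ (⊨-reverse-transfer φ (m⊔n≤o⇒m≤o _ _ r≥) s h)
⊨-reverse-transfer (φ ∨ᶠ ψ) r≥ s (inj₂ h) = inj₂ (⊨-reverse-transfer ψ (m⊔n≤o⇒n≤o _ _ r≥) s h)
⊨-reverse-transfer (φ ⇒ᶠ ψ) r≥ s h h' =
  ⊨-reverse-transfer ψ (m⊔n≤o⇒n≤o _ _ r≥) s (h (⊨-reverse-transfer φ (m⊔n≤o⇒m≤o _ _ r≥) (Similar-sym s) h'))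
⊨-reverse-transfer {r = suc r} (∀ᶠ φ) (s≤s r≥) s h α' =
  let α , s' = duplicator-move-Fin (m^n>0 2 r) (Similar-sym s) α'
  in ⊨-reverse-transfer φ r≥ (Similar-sym s') (h α)
⊨-reverse-transfer {r = suc r} (∃ᶠ φ) (s≤s r≥) s (α , h) =
  let β , s' = duplicator-move-Fin (m^n>0 2 r) s α
  in β , ⊨-reverse-transfer φ r≥ s' h

reverse-fixedPoint : ∀ m → HasFixedPoint (reverse {n = suc (2 * m)})
reverse-fixedPoint m = i , toℕ-injective (begin
  toℕ (opposite i)           ≡⟨ opposite-prop i ⟩
  suc (2 * m) ∸ suc (toℕ i)  ≡⟨ cong (2 * m ∸_) (toℕ-fromℕ< m<1+2m) ⟩
  m + (m + 0) ∸ m            ≡⟨ m+n∸m≡n m (m + 0) ⟩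
  m + 0                      ≡⟨ +-identityʳ m ⟩
  m                          ≡⟨ toℕ-fromℕ< m<1+2m ⟨
  toℕ i                      ∎)
  where
  open ≡-Reasoning
  m<1+2m : m < suc (2 * m)
  m<1+2m = s≤s (m≤m+n m (m + 0))
  i : Fin (suc (2 * m))
  i = fromℕ< m<1+2m

reverse-noFixedPoint : ∀ m → ¬ HasFixedPoint (reverse {n = 2 * m})
reverse-noFixedPoint m (i , opp-i≡i) = even≢odd m j (begin
  2 * m                   ≡⟨ m∸n+n≡m (toℕ<n i) ⟨
  (2 * m ∸ suc j) + suc j ≡⟨ cong (_+ suc j) (trans (sym (opposite-prop i)) (cong toℕ opp-i≡i)) ⟩
  j + suc j               ≡⟨ +-suc j j ⟩
  suc (j + j)             ≡⟨ cong (λ y → suc (j + y)) (+-identityʳ j) ⟨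
  suc (2 * j)             ∎)
  where
  open ≡-Reasoning
  j : ℕ
  j = toℕ i

corollary4p4 : ¬ (Σ Sentence λ ψ → (n : ℕ) (σ : Permutation′ n) → (σ ⊨ ψ) ⇔ HasFixedPoint σ)
corollary4p4 (ψ , ψ⇔fixed) = reverse-noFixedPoint T (Equivalence.to (ψ⇔fixed _ reverse) ψ-on-even)
  where
  T : ℕ
  T = 2 ^ rank ψ
  T≤2T : T ≤ 2 * T
  T≤2T = m≤m+n T (T + 0)
  ψ-on-odd : reverse {n = suc (2 * T)} ⊨ ψ
  ψ-on-odd = Equivalence.from (ψ⇔fixed _ reverse) (reverse-fixedPoint T)
  ψ-on-even : reverse {n = 2 * T} ⊨ ψ
  ψ-on-even = ⊨-reverse-transfer ψ ≤-refl
    (Similar-ρ₀ (m≤n⇒m≤1+n (m≤n⇒m≤1+n T≤2T)) (m≤n⇒m≤1+n T≤2T)) ψ-on-odd
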